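{- The variety of $\mathsf V$-algebras is the equivalent algebraic semantics (in the sense of Blok–Pigozzi) of $\mathbf{GV}$.
   Context: A $\mathsf V$-algebra (Lewis variably strict conditional algebra) is an algebra $(C,\wedge,\vee,\to,\mathbin{\Box\!\!\rightarrow},0,1)$ where $(C,\wedge,\vee,\to,0,1)$ is a Boolean algebra and $\mathbin{\Box\!\!\rightarrow}$ is a binary operation such that for all $x,y,z$: (1) $x\mathbin{\Box\!\!\rightarrow}x=1$; (2) $((x\mathbin{\Box\!\!\rightarrow}y)\wedge(y\mathbin{\Box\!\!\rightarrow}x))\le((x\mathbin{\Box\!\!\rightarrow}z)\leftrightarrow(y\mathbin{\Box\!\!\rightarrow}z))$; (3) $((x\vee y)\mathbin{\Box\!\!\rightarrow}x)\vee((x\vee y)\mathbin{\Box\!\!\rightarrow}y)\vee(((x\vee y)\mathbin{\Box\!\!\rightarrow}z)\leftrightarrow((x\mathbin{\Box\!\!\rightarrow}z)\wedge(y\mathbin{\Box\!\!\rightarrow}z)))=1$; (4) $x\mathbin{\Box\!\!\rightarrow}(y\wedge z)=(x\mathbin{\Box\!\!\rightarrow}y)\wedge(x\mathbin{\Box\!\!\rightarrow}z)$. $\mathbf{GV}$ is the smallest finitary consequence relation in the language $\{\land,\lor,\to,\mathbin{\Box\!\!\rightarrow},0,1\}$ containing classical propositional axioms and (L1) $\varphi\mathbin{\Box\!\!\rightarrow}\varphi$, (L2) $((\varphi\mathbin{\Box\!\!\rightarrow}\psi)\wedge(\psi\mathbin{\Box\!\!\rightarrow}\varphi))\to((\varphi\mathbin{\Box\!\!\rightarrow}\gamma)\leftrightarrow(\psi\mathbin{\Box\!\!\rightarrow}\gamma))$,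 (L3) $((\varphi\vee\psi)\mathbin{\Box\!\!\rightarrow}\varphi)\vee((\varphi\vee\psi)\mathbin{\Box\!\!\rightarrow}\psi)\vee(((\varphi\vee\psi)\mathbin{\Box\!\!\rightarrow}\gamma)\leftrightarrow((\varphi\mathbin{\Box\!\!\rightarrow}\gamma)\wedge(\psi\mathbin{\Box\!\!\rightarrow}\gamma)))$, (L4) $(\varphi\mathbin{\Box\!\!\rightarrow}(\psi\land\gamma))\leftrightarrow((\varphi\mathbin{\Box\!\!\rightarrow}\psi)\land(\varphi\mathbin{\Box\!\!\rightarrow}\gamma))$, and closed under modus ponens and (C) $\varphi\to\psi\vdash(\gamma\mathbin{\Box\!\!\rightarrow}\varphi)\to(\gamma\mathbin{\Box\!\!\rightarrow}\psi)$. Equivalent algebraic semantics is witnessed by the defining equation $\tau(x)=\{x\approx1\}$ and equivalence formula $\Delta(x,y)=\{x\leftrightarrow y\}$: $\Gamma\vdash_{\mathbf{GV}}\varphi$ iff $\tau(\Gamma)\models\tau(\varphi)$ in the class, and $x\approx y$ is interderivable with $\tau(\Delta(x,y))$. -}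

module Defs where

open import Level using (Level; _⊔_; 0ℓ) renaming (suc to lsuc)
open import Data.Nat using (ℕ)
open import Data.Product using (_×_)
open import Algebra.Core using (Op₂)
open import Algebra.Lattice.Bundles using (BooleanAlgebra)
open import Function.Bundles using (_⇔_)

infixr 7 _∧'_
infixr 6 _∨'_
infixr 5 _□→'_
infixr 4 _→'_
infix  4 _↔'_

data Fm : Set where
  var   : ℕ → Fm
  _∧'_  : Fm → Fm → Fm
  _∨'_  : Fm → Fm → Fm
  _→'_  : Fm → Fm → Fm
  _□→'_ : Fm → Fm → Fm
  𝟘 𝟙   : Fm

_↔'_ : Fm → Fm → Fm
φ ↔' ψ = (φ →' ψ) ∧' (ψ →' φ)

-- Axioms of GV: a standard complete Hilbert axiomatisation of classical
-- propositional logic (all instances), plus (L1)–(L4).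

data Axiom : Fm → Set where
  K    : ∀ φ ψ → Axiom (φ →' (ψ →' φ))
  S    : ∀ φ ψ χ → Axiom ((φ →' (ψ →' χ)) →' ((φ →' ψ) →' (φ →' χ)))
  ∧E₁  : ∀ φ ψ → Axiom ((φ ∧' ψ) →' φ)
  ∧E₂  : ∀ φ ψ → Axiom ((φ ∧' ψ) →' ψ)
  ∧I   : ∀ φ ψ → Axiom (φ →' (ψ →' (φ ∧' ψ)))
  ∨I₁  : ∀ φ ψ → Axiom (φ →' (φ ∨' ψ))
  ∨I₂  : ∀ φ ψ → Axiom (ψ →' (φ ∨' ψ))
  ∨E   : ∀ φ ψ χ → Axiom ((φ →' χ) →' ((ψ →' χ) →' ((φ ∨' ψ) →' χ)))
  0E   : ∀ φ → Axiom (𝟘 →' φ)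
  1I   : Axiom 𝟙
  DN   : ∀ φ → Axiom (((φ →' 𝟘) →' 𝟘) →' φ)
  L1   : ∀ φ → Axiom (φ □→' φ)
  L2   : ∀ φ ψ γ → Axiom (((φ □→' ψ) ∧' (ψ □→' φ)) →' ((φ □→' γ) ↔' (ψ □→' γ)))
  L3   : ∀ φ ψ γ → Axiom (((φ ∨' ψ) □→' φ) ∨' ((φ ∨' ψ) □→' ψ)
                          ∨' (((φ ∨' ψ) □→' γ) ↔' ((φ □→' γ) ∧' (ψ □→' γ))))
  L4   : ∀ φ ψ γ → Axiom ((φ □→' (ψ ∧' γ)) ↔' ((φ □→' ψ) ∧' (φ □→' γ)))

infix 3 _⊢_
data _⊢_ (Γ : Fm → Set) : Fm → Set where
  hyp : ∀ {φ} → Γ φ → Γ ⊢ φ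
  ax  : ∀ {φ} → Axiom φ → Γ ⊢ φ
  mp  : ∀ {φ ψ} → Γ ⊢ φ → Γ ⊢ (φ →' ψ) → Γ ⊢ ψ
  ruleC : ∀ {φ ψ} γ → Γ ⊢ (φ →' ψ) → Γ ⊢ ((γ □→' φ) →' (γ □→' ψ))

record VAlgebra (c ℓ : Level) : Set (lsuc (c ⊔ ℓ)) where
  field
    boolean : BooleanAlgebra c ℓ
  open BooleanAlgebra boolean public
  infixr 5 _□→_
  infixr 4 _⇒_
  field
    _⇒_    : Op₂ Carrier
    ⇒-def  : ∀ x y → (x ⇒ y) ≈ (¬ x ∨ y)
    _□→_   : Op₂ Carrier
    □→-cong : ∀ {x x' y y'} → x ≈ x' → y ≈ y' → (x □→ y) ≈ (x' □→ y')

  _⇔'_ : Op₂ Carrier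
  x ⇔' y = (x ⇒ y) ∧ (y ⇒ x)

  _≤_ : Carrier → Carrier → Set ℓ
  x ≤ y = (x ∧ y) ≈ x

  field
    V1 : ∀ x → (x □→ x) ≈ ⊤
    V2 : ∀ x y z → ((x □→ y) ∧ (y □→ x)) ≤ ((x □→ z) ⇔' (y □→ z))
    V3 : ∀ x y z → (((x ∨ y) □→ x) ∨ ((x ∨ y) □→ y)
                    ∨ (((x ∨ y) □→ z) ⇔' ((x □→ z) ∧ (y □→ z)))) ≈ ⊤
    V4 : ∀ x y z → (x □→ (y ∧ z)) ≈ ((x □→ y) ∧ (x □→ z))

module _ {c ℓ} (A : VAlgebra c ℓ) where
  open VAlgebra A

  ⟦_⟧ : Fm → (ℕ → Carrier) → Carrier
  ⟦ var n ⟧    v = v n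
  ⟦ φ ∧' ψ ⟧   v = ⟦ φ ⟧ v ∧ ⟦ ψ ⟧ v
  ⟦ φ ∨' ψ ⟧   v = ⟦ φ ⟧ v ∨ ⟦ ψ ⟧ v
  ⟦ φ →' ψ ⟧   v = ⟦ φ ⟧ v ⇒ ⟦ ψ ⟧ v
  ⟦ φ □→' ψ ⟧  v = ⟦ φ ⟧ v □→ ⟦ ψ ⟧ v
  ⟦ 𝟘 ⟧        v = ⊥
  ⟦ 𝟙 ⟧        v = ⊤

-- τ(Γ) ⊨_V τ(φ): equational consequence relative to the class of all
-- V-algebras (of carrier level c and equality level ℓ), with τ(x) = {x ≈ 1}.
_⊨[_,_]_ : (Fm → Set) → (c ℓ : Level) → Fm → Set (lsuc (c ⊔ ℓ))
Γ ⊨[ c , ℓ ] φ =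
  (A : VAlgebra c ℓ) (v : ℕ → VAlgebra.Carrier A) →
  (∀ ψ → Γ ψ → VAlgebra._≈_ A (⟦ A ⟧ ψ v) (VAlgebra.⊤ A)) →
  VAlgebra._≈_ A (⟦ A ⟧ φ v) (VAlgebra.⊤ A)

-- Blok–Pigozzi: the class of V-algebras is an equivalent algebraic
-- semantics of GV with τ(x) = {x ≈ 1} and Δ(x,y) = {x ↔ y}.
IsEquivalentAlgebraicSemantics : (c ℓ : Level) → Set (lsuc (c ⊔ ℓ))
IsEquivalentAlgebraicSemantics c ℓ =
  (∀ (Γ : Fm → Set) (φ : Fm) → (Γ ⊢ φ) ⇔ (Γ ⊨[ c , ℓ ] φ))
  × (∀ (A : VAlgebra c ℓ) (a b : VAlgebra.Carrier A) →
       VAlgebra._≈_ A a b ⇔ VAlgebra._≈_ A (VAlgebra._⇔'_ A a b) (VAlgebra.⊤ A))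

{-# OPTIONS --safe #-}
-- A V-algebra is a Boolean algebra, hence a Heyting algebra whose exponential is ⇒.
-- Soundness: the propositional axioms hold in every Heyting algebra with double
-- negation, (L1)–(L4) are the equations (1)–(4), and (C) is monotonicity of z □→_,
-- which follows from (4).  Completeness: formulas preordered by Γ ⊢ φ →' ψ form a
-- Heyting algebra with excluded middle, hence a Boolean algebra, and (L1)–(L4)
-- make it a V-algebra in which, under the canonical valuation, φ ≈ ⊤ iff Γ ⊢ φ.
-- The second clause is the Heyting-algebra fact x ≈ y iff (x ⇨ y) ∧ (y ⇨ x) ≈ ⊤.
module Submission where

open import Defs
open import Level using (Level; Lift; lift; lower)
open import Algebra.Core using (Op₂)
open import Algebra.Lattice.Bundles using (BooleanAlgebra)
open import Algebra.Lattice.Structures.Biased using (isDistributiveLatticeʳʲᵐ; isBooleanAlgebraʳ)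
open import Data.List using (List; []; _∷_)
open import Data.List.Membership.Propositional using (_∈_)
open import Data.List.Relation.Unary.Any using (here; there)
open import Data.Nat using (ℕ)
open import Data.Product using (_×_; _,_; proj₁; proj₂; swap; zip)
open import Function.Base using (flip)
open import Function.Bundles using (_⇔_; mk⇔; Equivalence)
open import Relation.Binary.PropositionalEquality as ≡ using (_≡_)
import Relation.Binary.Lattice as R
import Relation.Binary.Reasoning.PartialOrder as ≤-Reasoning

module _ {c ℓ} (B : BooleanAlgebra c ℓ) where
  open BooleanAlgebra B

  module _ (_⇒_ : Op₂ Carrier) (⇒-def : ∀ x y → (x ⇒ y) ≈ (¬ x ∨ y)) where

    open import Algebra.Lattice.Properties.Lattice lattice
      using (poset; ∨-∧-isOrderTheoreticLattice; ∨-∧-orderTheoreticLattice)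
    open import Algebra.Lattice.Properties.BooleanAlgebra B
      using (∧-identityʳ; ∧-zeroˡ; ∨-identityˡ; ∨-identityʳ; ¬-involutive)
    open R.Lattice ∨-∧-orderTheoreticLattice
      using (_≤_; x∧y≤x; x∧y≤y; meetSemilattice; joinSemilattice) renaming (refl to ≤-refl)
    open import Relation.Binary.Lattice.Properties.MeetSemilattice meetSemilattice
      using (∧-monotonic)
    open import Relation.Binary.Lattice.Properties.JoinSemilattice joinSemilattice
      using (∨-monotonic)
    open ≤-Reasoning poset

    ⇒-exponential : R.Exponential _≤_ _∧_ _⇒_
    ⇒-exponential w x y = curry , uncurry
      where
      curry : w ∧ x ≤ y → w ≤ x ⇒ y
      curry w∧x≤y = begin
        w                      ≈⟨ sym (∧-identityʳ w) ⟩
        w ∧ ⊤                  ≈⟨ ∧-congˡ (sym (∨-complementʳ x)) ⟩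
        w ∧ (x ∨ ¬ x)          ≈⟨ ∧-distribˡ-∨ w x (¬ x) ⟩
        (w ∧ x) ∨ (w ∧ ¬ x)    ≤⟨ ∨-monotonic w∧x≤y (x∧y≤y w (¬ x)) ⟩
        y ∨ ¬ x                ≈⟨ ∨-comm y (¬ x) ⟩
        ¬ x ∨ y                ≈⟨ sym (⇒-def x y) ⟩
        x ⇒ y                  ∎
      uncurry : w ≤ x ⇒ y → w ∧ x ≤ y
      uncurry w≤x⇒y = begin
        w ∧ x                  ≤⟨ ∧-monotonic w≤x⇒y ≤-refl ⟩
        (x ⇒ y) ∧ x            ≈⟨ ∧-congʳ (⇒-def x y) ⟩
        (¬ x ∨ y) ∧ x          ≈⟨ ∧-distribʳ-∨ x (¬ x) y ⟩
        (¬ x ∧ x) ∨ (y ∧ x)    ≈⟨ ∨-congʳ (∧-complementˡ x) ⟩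
        ⊥ ∨ (y ∧ x)            ≈⟨ ∨-identityˡ (y ∧ x) ⟩
        y ∧ x                  ≤⟨ x∧y≤x y x ⟩
        y                      ∎

    booleanHeytingAlgebra : R.HeytingAlgebra c ℓ ℓ
    booleanHeytingAlgebra = record
      { _⇨_ = _⇒_
      ; isHeytingAlgebra = record
        { isBoundedLattice = record
          { isLattice = ∨-∧-isOrderTheoreticLattice
          ; maximum   = λ x → sym (∧-identityʳ x)
          ; minimum   = λ x → sym (∧-zeroˡ x)
          }
        ; exponential = ⇒-exponential
        }
      }

    ⇒⊥-involutive : ∀ x → ((x ⇒ ⊥) ⇒ ⊥) ≈ x
    ⇒⊥-involutive x = begin-equality
      (x ⇒ ⊥) ⇒ ⊥      ≈⟨ ⇒-def (x ⇒ ⊥) ⊥ ⟩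
      ¬ (x ⇒ ⊥) ∨ ⊥    ≈⟨ ∨-identityʳ _ ⟩
      ¬ (x ⇒ ⊥)        ≈⟨ ¬-cong (⇒-def x ⊥) ⟩
      ¬ (¬ x ∨ ⊥)      ≈⟨ ¬-cong (∨-identityʳ (¬ x)) ⟩
      ¬ ¬ x            ≈⟨ ¬-involutive x ⟩
      x                ∎

module HeytingAlgebraProperties {c ℓ₁ ℓ₂} (H : R.HeytingAlgebra c ℓ₁ ℓ₂) where
  open R.HeytingAlgebra H
  open import Relation.Binary.Lattice.Properties.HeytingAlgebra H
    using (⇨-eval)
  open import Relation.Binary.Lattice.Properties.MeetSemilattice meetSemilattice
    using (∧-monotonic)
  open ≤-Reasoning poset

  ≤⇒⇨≈⊤ : ∀ {x y} → x ≤ y → (x ⇨ y) ≈ ⊤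
  ≤⇒⇨≈⊤ x≤y = antisym (maximum _) (transpose-⇨ (trans (x∧y≤y _ _) x≤y))

  ⇨≈⊤⇒≤ : ∀ {x y} → (x ⇨ y) ≈ ⊤ → x ≤ y
  ⇨≈⊤⇒≤ {x} x⇨y≈⊤ =
    trans (∧-greatest (maximum x) refl) (transpose-∧ (reflexive (Eq.sym x⇨y≈⊤)))

  ≈⊤-⇨-elim : ∀ {x y} → x ≈ ⊤ → (x ⇨ y) ≈ ⊤ → y ≈ ⊤
  ≈⊤-⇨-elim x≈⊤ x⇨y≈⊤ =
    antisym (maximum _) (trans (reflexive (Eq.sym x≈⊤)) (⇨≈⊤⇒≤ x⇨y≈⊤))

  ≈⇔⇨∧⇨≈⊤ : ∀ {x y} → x ≈ y ⇔ ((x ⇨ y) ∧ (y ⇨ x)) ≈ ⊤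
  ≈⇔⇨∧⇨≈⊤ = mk⇔
    (λ x≈y → antisym (maximum _)
       (∧-greatest (reflexive (Eq.sym (≤⇒⇨≈⊤ (reflexive x≈y))))
                   (reflexive (Eq.sym (≤⇒⇨≈⊤ (reflexive (Eq.sym x≈y)))))))
    (λ ⇨∧⇨≈⊤ → antisym (⇨≈⊤⇒≤ (≈⊤-∧-elim₁ ⇨∧⇨≈⊤)) (⇨≈⊤⇒≤ (≈⊤-∧-elim₂ ⇨∧⇨≈⊤)))
    where
    ≈⊤-∧-elim₁ : ∀ {x y} → (x ∧ y) ≈ ⊤ → x ≈ ⊤
    ≈⊤-∧-elim₁ x∧y≈⊤ = antisym (maximum _) (trans (reflexive (Eq.sym x∧y≈⊤)) (x∧y≤x _ _))
    ≈⊤-∧-elim₂ : ∀ {x y} → (x ∧ y) ≈ ⊤ → y ≈ ⊤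
    ≈⊤-∧-elim₂ x∧y≈⊤ = antisym (maximum _) (trans (reflexive (Eq.sym x∧y≈⊤)) (x∧y≤y _ _))

  ⇨-distribˡ-⇨-≤ : ∀ x y z → (x ⇨ (y ⇨ z)) ≤ ((x ⇨ y) ⇨ (x ⇨ z))
  ⇨-distribˡ-⇨-≤ x y z = transpose-⇨ (transpose-⇨ (begin
    ((x ⇨ y ⇨ z) ∧ (x ⇨ y)) ∧ x         ≤⟨ ∧-greatest (∧-monotonic (x∧y≤x _ _) refl)
                                                      (∧-monotonic (x∧y≤y _ _) refl) ⟩
    ((x ⇨ y ⇨ z) ∧ x) ∧ ((x ⇨ y) ∧ x)   ≤⟨ ∧-monotonic ⇨-eval ⇨-eval ⟩
    (y ⇨ z) ∧ y                          ≤⟨ ⇨-eval ⟩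
    z                                    ∎))

module _ {c ℓ₁ ℓ₂} (H : R.HeytingAlgebra c ℓ₁ ℓ₂) where
  open R.HeytingAlgebra H
  open import Relation.Binary.Lattice.Properties.HeytingAlgebra H
    using (¬_; ⇨-eval; ⇨-cong; ⇨ʳ-covariant; y≤x⇨y; ∧-distribˡ-∨; distributiveLattice)
  open import Relation.Binary.Lattice.Properties.Lattice lattice using (isAlgLattice)
  open import Relation.Binary.Lattice.Properties.DistributiveLattice distributiveLattice
    using (∨-distribʳ-∧)
  open import Relation.Binary.Lattice.Properties.MeetSemilattice meetSemilattice
    using (∧-comm)
  open ≤-Reasoning poset

  module _ (excluded-middle : ∀ x → (x ∨ ¬ x) ≈ ⊤) where

    classicalBooleanAlgebra : BooleanAlgebra c ℓ₁
    classicalBooleanAlgebra = record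
      { isBooleanAlgebra = isBooleanAlgebraʳ record
        { isDistributiveLattice = isDistributiveLatticeʳʲᵐ record
          { isLattice    = isAlgLattice
          ; ∨-distribʳ-∧ = ∨-distribʳ-∧
          }
        ; ∨-complementʳ = excluded-middle
        ; ∧-complementʳ = λ x → antisym (trans (reflexive (∧-comm x (¬ x))) ⇨-eval) (minimum _)
        ; ¬-cong        = λ x≈y → ⇨-cong x≈y Eq.refl
        }
      }

    ⇨≈¬∨ : ∀ x y → (x ⇨ y) ≈ (¬ x ∨ y)
    ⇨≈¬∨ x y = antisym ⇨≤¬∨ (∨-least (⇨ʳ-covariant (minimum y)) y≤x⇨y)
      where
      ⇨≤¬∨ : (x ⇨ y) ≤ (¬ x ∨ y)
      ⇨≤¬∨ = begin
        x ⇨ y                            ≤⟨ ∧-greatest refl (trans (maximum _)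
                                                       (reflexive (Eq.sym (excluded-middle x)))) ⟩
        (x ⇨ y) ∧ (x ∨ ¬ x)              ≈⟨ ∧-distribˡ-∨ (x ⇨ y) x (¬ x) ⟩
        ((x ⇨ y) ∧ x) ∨ ((x ⇨ y) ∧ ¬ x)  ≤⟨ ∨-least (trans ⇨-eval (y≤x∨y _ _))
                                                     (trans (x∧y≤y _ _) (x≤x∨y _ _)) ⟩
        ¬ x ∨ y                          ∎

module VAlgebraProperties {c ℓ} (A : VAlgebra c ℓ) where
  open VAlgebra A hiding (_≤_)

  heytingAlgebra : R.HeytingAlgebra c ℓ ℓ
  heytingAlgebra = booleanHeytingAlgebra boolean _⇒_ ⇒-def

  -- Here x ≤ y unfolds to x ≈ x ∧ y, the converse orientation of VAlgebra._≤_.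
  open R.HeytingAlgebra heytingAlgebra
    using (_≤_; x∧y≤x; x∧y≤y; x≤x∨y; y≤x∨y; minimum; transpose-⇨)
    renaming (refl to ≤-refl; reflexive to ≤-reflexive)
  open import Relation.Binary.Lattice.Properties.HeytingAlgebra heytingAlgebra
    using (y≤x⇨y; ⇨-distribˡ-∨-∧-≥)
  open HeytingAlgebraProperties heytingAlgebra public

  □→-monotoneʳ : ∀ {x y} z → x ≤ y → (z □→ x) ≤ (z □→ y)
  □→-monotoneʳ {x} {y} z x≈x∧y = trans (□→-cong refl x≈x∧y) (V4 z x y)

  axiom-valid : ∀ {φ} → Axiom φ → ∀ v → ⟦ A ⟧ φ v ≈ ⊤
  axiom-valid (K _ _)      v = ≤⇒⇨≈⊤ y≤x⇨y
  axiom-valid (S _ _ _)    v = ≤⇒⇨≈⊤ (⇨-distribˡ-⇨-≤ _ _ _)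
  axiom-valid (∧E₁ _ _)    v = ≤⇒⇨≈⊤ (x∧y≤x _ _)
  axiom-valid (∧E₂ _ _)    v = ≤⇒⇨≈⊤ (x∧y≤y _ _)
  axiom-valid (∧I _ _)     v = ≤⇒⇨≈⊤ (transpose-⇨ ≤-refl)
  axiom-valid (∨I₁ _ _)    v = ≤⇒⇨≈⊤ (x≤x∨y _ _)
  axiom-valid (∨I₂ _ _)    v = ≤⇒⇨≈⊤ (y≤x∨y _ _)
  axiom-valid (∨E _ _ _)   v = ≤⇒⇨≈⊤ (transpose-⇨ (⇨-distribˡ-∨-∧-≥ _ _ _))
  axiom-valid (0E _)       v = ≤⇒⇨≈⊤ (minimum _)
  axiom-valid 1I           v = refl
  axiom-valid (DN _)       v = ≤⇒⇨≈⊤ (≤-reflexive (⇒⊥-involutive boolean _⇒_ ⇒-def _))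
  axiom-valid (L1 _)       v = V1 _
  axiom-valid (L2 _ _ _)   v = ≤⇒⇨≈⊤ (sym (V2 _ _ _))
  axiom-valid (L3 _ _ _)   v = V3 _ _ _
  axiom-valid (L4 _ _ _)   v = Equivalence.to ≈⇔⇨∧⇨≈⊤ (V4 _ _ _)

  derivable-valid : ∀ {Γ φ} → Γ ⊢ φ → ∀ v → (∀ ψ → Γ ψ → ⟦ A ⟧ ψ v ≈ ⊤) → ⟦ A ⟧ φ v ≈ ⊤
  derivable-valid (hyp Γφ)    v ⊨Γ = ⊨Γ _ Γφ
  derivable-valid (ax a)      v ⊨Γ = axiom-valid a v
  derivable-valid (mp d e)    v ⊨Γ = ≈⊤-⇨-elim (derivable-valid d v ⊨Γ) (derivable-valid e v ⊨Γ)
  derivable-valid (ruleC γ d) v ⊨Γ =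
    ≤⇒⇨≈⊤ (□→-monotoneʳ (⟦ A ⟧ γ v) (⇨≈⊤⇒≤ (derivable-valid d v ⊨Γ)))

soundness : ∀ {c ℓ Γ φ} → Γ ⊢ φ → Γ ⊨[ c , ℓ ] φ
soundness d A = VAlgebraProperties.derivable-valid A d

-- Theorems of Γ enter only as closed facts, so the deduction theorem →-intro holds,
-- although it fails for _⊢_ itself, where (C) may be applied to a hypothesis.
module NaturalDeduction (Γ : Fm → Set) where

  infix 3 _⊩_
  data _⊩_ (Δ : List Fm) : Fm → Set where
    thm    : ∀ {φ} → Γ ⊢ φ → Δ ⊩ φ
    assume : ∀ {φ} → φ ∈ Δ → Δ ⊩ φ
    →-elim : ∀ {φ ψ} → Δ ⊩ (φ →' ψ) → Δ ⊩ φ → Δ ⊩ ψ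

  private variable
    Δ : List Fm
    φ ψ χ : Fm

  closed : [] ⊩ φ → Γ ⊢ φ
  closed (thm d)      = d
  closed (→-elim d e) = mp (closed e) (closed d)

  axiom : Axiom φ → Δ ⊩ φ
  axiom a = thm (ax a)

  →-intro : (φ ∷ Δ) ⊩ ψ → Δ ⊩ (φ →' ψ)
  →-intro {φ} (assume (here ≡.refl)) =
    →-elim (→-elim (axiom (S φ (φ →' φ) φ)) (axiom (K φ (φ →' φ)))) (axiom (K φ φ))
  →-intro (assume (there p)) = →-elim (axiom (K _ _)) (assume p)
  →-intro (thm d)            = →-elim (axiom (K _ _)) (thm d)
  →-intro (→-elim d e)       = →-elim (→-elim (axiom (S _ _ _)) (→-intro d)) (→-intro e)

  #0 : (φ ∷ Δ) ⊩ φ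
  #0 = assume (here ≡.refl)

  #1 : (ψ ∷ φ ∷ Δ) ⊩ φ
  #1 = assume (there (here ≡.refl))

  ∧-intro : Δ ⊩ φ → Δ ⊩ ψ → Δ ⊩ (φ ∧' ψ)
  ∧-intro d e = →-elim (→-elim (axiom (∧I _ _)) d) e

  ∧-elim₁ : Δ ⊩ (φ ∧' ψ) → Δ ⊩ φ
  ∧-elim₁ = →-elim (axiom (∧E₁ _ _))

  ∧-elim₂ : Δ ⊩ (φ ∧' ψ) → Δ ⊩ ψ
  ∧-elim₂ = →-elim (axiom (∧E₂ _ _))

  ∨-intro₁ : Δ ⊩ φ → Δ ⊩ (φ ∨' ψ)
  ∨-intro₁ = →-elim (axiom (∨I₁ _ _))

  ∨-intro₂ : Δ ⊩ ψ → Δ ⊩ (φ ∨' ψ)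
  ∨-intro₂ = →-elim (axiom (∨I₂ _ _))

  ∨-elim : Δ ⊩ (φ ∨' ψ) → (φ ∷ Δ) ⊩ χ → (ψ ∷ Δ) ⊩ χ → Δ ⊩ χ
  ∨-elim d e f = →-elim (→-elim (→-elim (axiom (∨E _ _ _)) (→-intro e)) (→-intro f)) d

  𝟘-elim : Δ ⊩ 𝟘 → Δ ⊩ φ
  𝟘-elim = →-elim (axiom (0E _))

  𝟙-intro : Δ ⊩ 𝟙
  𝟙-intro = axiom 1I

  by-contradiction : ((φ →' 𝟘) ∷ Δ) ⊩ 𝟘 → Δ ⊩ φ
  by-contradiction d = →-elim (axiom (DN _)) (→-intro d)

  excluded-middle : Δ ⊩ (φ ∨' (φ →' 𝟘))
  excluded-middle = by-contradiction (→-elim #0 (∨-intro₂ (→-intro (→-elim #1 (∨-intro₁ #0)))))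

module Lindenbaum (c ℓ : Level) (Γ : Fm → Set) where
  open NaturalDeduction Γ

  Carrier : Set c
  Carrier = Lift c Fm

  infix 4 _≤_ _≈_
  _≤_ : Carrier → Carrier → Set ℓ
  x ≤ y = Lift ℓ (Γ ⊢ lower x →' lower y)

  _≈_ : Carrier → Carrier → Set ℓ
  x ≈ y = x ≤ y × y ≤ x

  ≤-intro : ∀ {x y} → (lower x ∷ []) ⊩ lower y → x ≤ y
  ≤-intro d = lift (closed (→-intro d))

  ≤-apply : ∀ {Δ x y} → x ≤ y → Δ ⊩ lower x → Δ ⊩ lower y
  ≤-apply (lift x→y) = →-elim (thm x→y)

  ≤-refl : ∀ {x} → x ≤ x
  ≤-refl = ≤-intro #0

  ≤-trans : ∀ {x y z} → x ≤ y → y ≤ z → x ≤ z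
  ≤-trans x≤y y≤z = ≤-intro (≤-apply y≤z (≤-apply x≤y #0))

  lift₂ : (Fm → Fm → Fm) → Carrier → Carrier → Carrier
  lift₂ _∙_ x y = lift (lower x ∙ lower y)

  heytingAlgebra : R.HeytingAlgebra c ℓ ℓ
  heytingAlgebra = record
    { Carrier = Carrier
    ; _≈_     = _≈_
    ; _≤_     = _≤_
    ; _∨_     = lift₂ _∨'_
    ; _∧_     = lift₂ _∧'_
    ; _⇨_     = lift₂ _→'_
    ; ⊤       = lift 𝟙
    ; ⊥       = lift 𝟘
    ; isHeytingAlgebra = record
      { isBoundedLattice = record
        { isLattice = record
          { isPartialOrder = record
            { isPreorder = record
              { isEquivalence = record
                { refl  = ≤-refl , ≤-refl
                ; sym   = swap
                ; trans = zip ≤-trans (flip ≤-trans)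
                }
              ; reflexive = proj₁
              ; trans     = ≤-trans
              }
            ; antisym = _,_
            }
          ; supremum = λ _ _ →
              ≤-intro (∨-intro₁ #0) , ≤-intro (∨-intro₂ #0) ,
              λ _ x≤z y≤z → ≤-intro (∨-elim #0 (≤-apply x≤z #0) (≤-apply y≤z #0))
          ; infimum = λ _ _ →
              ≤-intro (∧-elim₁ #0) , ≤-intro (∧-elim₂ #0) ,
              λ _ z≤x z≤y → ≤-intro (∧-intro (≤-apply z≤x #0) (≤-apply z≤y #0))
          }
        ; maximum = λ _ → ≤-intro 𝟙-intro
        ; minimum = λ _ → ≤-intro (𝟘-elim #0)
        }
      ; exponential = λ _ _ _ →
          (λ w∧x≤y → ≤-intro (→-intro (≤-apply w∧x≤y (∧-intro #1 #0)))) ,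
          (λ w≤x⇨y → ≤-intro (→-elim (≤-apply w≤x⇨y (∧-elim₁ #0)) (∧-elim₂ #0)))
      }
    }

  ⊢⇒≈⊤ : ∀ {φ} → Γ ⊢ φ → lift φ ≈ lift 𝟙
  ⊢⇒≈⊤ d = ≤-intro 𝟙-intro , ≤-intro (thm d)

  ≤⇒∧≈ : ∀ {x y} → x ≤ y → lift₂ _∧'_ x y ≈ x
  ≤⇒∧≈ x≤y = ≤-intro (∧-elim₁ #0) , ≤-intro (∧-intro #0 (≤-apply x≤y #0))

  ↔⇒≈ : ∀ {φ ψ} → Γ ⊢ (φ ↔' ψ) → lift φ ≈ lift ψ
  ↔⇒≈ d = lift (closed (∧-elim₁ (thm d))) , lift (closed (∧-elim₂ (thm d)))

  →⇒□→ : ∀ {φ ψ} → Γ ⊢ (φ →' ψ) → Γ ⊢ (φ □→' ψ)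
  →⇒□→ {φ} φ→ψ = mp (ax (L1 φ)) (ruleC φ φ→ψ)

  □→-monotone : ∀ {x x' y y'} → x ≈ x' → y ≤ y' → lift₂ _□→'_ x y ≤ lift₂ _□→'_ x' y'
  □→-monotone {x} {x'} (lift x→x' , lift x'→x) (lift y→y') =
    ≤-intro (→-elim (thm (ruleC (lower x') y→y'))
                    (→-elim (∧-elim₁ (→-elim (axiom (L2 _ _ _)) x⇄x')) #0))
    where
    x⇄x' : ∀ {Δ} → Δ ⊩ ((lower x □→' lower x') ∧' (lower x' □→' lower x))
    x⇄x' = ∧-intro (thm (→⇒□→ x→x')) (thm (→⇒□→ x'→x))

  x∨¬x≈⊤ : ∀ x → lift₂ _∨'_ x (lift₂ _→'_ x (lift 𝟘)) ≈ lift 𝟙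
  x∨¬x≈⊤ x = ≤-intro 𝟙-intro , ≤-intro excluded-middle

  vAlgebra : VAlgebra c ℓ
  vAlgebra = record
    { boolean = classicalBooleanAlgebra heytingAlgebra x∨¬x≈⊤
    ; _⇒_     = lift₂ _→'_
    ; ⇒-def   = ⇨≈¬∨ heytingAlgebra x∨¬x≈⊤
    ; _□→_    = lift₂ _□→'_
    ; □→-cong = λ x≈x' y≈y' →
        □→-monotone x≈x' (proj₁ y≈y') , □→-monotone (swap x≈x') (proj₂ y≈y')
    ; V1 = λ _ → ⊢⇒≈⊤ (ax (L1 _))
    ; V2 = λ _ _ _ → ≤⇒∧≈ (lift (ax (L2 _ _ _)))
    ; V3 = λ _ _ _ → ⊢⇒≈⊤ (ax (L3 _ _ _))
    ; V4 = λ _ _ _ → ↔⇒≈ (ax (L4 _ _ _))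
    }

  canonical : ℕ → Carrier
  canonical n = lift (var n)

  ⟦⟧-canonical : ∀ φ → lower (⟦ vAlgebra ⟧ φ canonical) ≡ φ
  ⟦⟧-canonical (var n)  = ≡.refl
  ⟦⟧-canonical (φ ∧' ψ) = ≡.cong₂ _∧'_ (⟦⟧-canonical φ) (⟦⟧-canonical ψ)
  ⟦⟧-canonical (φ ∨' ψ) = ≡.cong₂ _∨'_ (⟦⟧-canonical φ) (⟦⟧-canonical ψ)
  ⟦⟧-canonical (φ →' ψ) = ≡.cong₂ _→'_ (⟦⟧-canonical φ) (⟦⟧-canonical ψ)
  ⟦⟧-canonical (φ □→' ψ) = ≡.cong₂ _□→'_ (⟦⟧-canonical φ) (⟦⟧-canonical ψ)
  ⟦⟧-canonical 𝟘 = ≡.refl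
  ⟦⟧-canonical 𝟙 = ≡.refl

  completeness : ∀ {φ} → Γ ⊨[ c , ℓ ] φ → Γ ⊢ φ
  completeness {φ} ⊨φ = closed (≤-apply ⊤≤φ 𝟙-intro)
    where
    ⊨Γ : ∀ ψ → Γ ψ → ⟦ vAlgebra ⟧ ψ canonical ≈ lift 𝟙
    ⊨Γ ψ Γψ = ≡.subst (λ χ → lift χ ≈ lift 𝟙) (≡.sym (⟦⟧-canonical ψ)) (⊢⇒≈⊤ (hyp Γψ))
    ⊤≤φ : lift 𝟙 ≤ lift φ
    ⊤≤φ = ≡.subst (λ χ → lift 𝟙 ≤ lift χ) (⟦⟧-canonical φ) (proj₂ (⊨φ vAlgebra canonical ⊨Γ))

theorem4p5 : ∀ (c ℓ : Level) → IsEquivalentAlgebraicSemantics c ℓ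
theorem4p5 c ℓ =
    (λ Γ φ → mk⇔ soundness (Lindenbaum.completeness c ℓ Γ))
  , (λ A a b → VAlgebraProperties.≈⇔⇨∧⇨≈⊤ A)
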